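{- For any compositional model $\mathbb{M}$, (1) $\mathbb{M}\models C(\phi)\vdash \bigwedge\{\Box_i\phi\land\Box_i C(\phi)\mid i\in \mathsf{Ag}\}$; (2) if $\mathbb{M}\models \chi\vdash\bigwedge_{i\in \mathsf{Ag}}\Box_i \phi$ and $\mathbb{M}\models \chi\vdash\bigwedge_{i\in \mathsf{Ag}}\Box_i\chi$, then $\mathbb{M}\models \chi\vdash C(\phi)$.
   Context: For $S\subseteq A\times X$ let $S^{\uparrow}[B]=\{x\mid \forall a\in B,\ aSx\}$, $S^{\downarrow}[Y]=\{a\mid \forall x\in Y,\ aSx\}$, $B^\uparrow=I^\uparrow[B]$, $Y^\downarrow=I^\downarrow[Y]$, $x^{\downarrow\uparrow}=\{x\}^{\downarrow\uparrow}$. A set is Galois-stable if $B=B^{\uparrow\downarrow}$ (resp. $Y=Y^{\downarrow\uparrow}$). A model $((A,X,I),\{R_i\}_{i\in\mathsf{Ag}},V)$ is compositional if every $R_i\subseteq A\times X$ is $I$-compatible ($R_i^\downarrow[\{x\}]$, $R_i^\uparrow[\{a\}]$ Galois-stable for all $x,a$). $V$ assigns to each atom a formal concept $([\![p]\!],(\![p]\!))$ (extension $\subseteq A$, description $\subseteq X$, each the $\downarrow$/$\uparrow$ of the other), extended by $[\![\top]\!]=A$, $(\![\bot]\!)=X$, $[\![\phi\wedge\psi]\!]=[\![\phi]\!]\cap[\![\psi]\!]$, $(\![\phi\vee\psi]\!)=(\![\phi]\!)\cap(\![\psi]\!)$, $[\![\Box_i\phi]\!]=R_i^\downarrow[(\![\phi]\!)]$,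 $[\![C(\phi)]\!]=R_C^\downarrow[(\![\phi]\!)]$, descriptions being $\uparrow$ of extensions. Here $S$ is the set of nonempty finite sequences of agents, $R_s$ is defined by $R_i$ for $s=i$ and $R_{it}^\downarrow[x]=R_i^\downarrow[I^\uparrow[R_t^\downarrow[x^{\downarrow\uparrow}]]]$, and $R_C=\bigcap_{s\in S}R_s$. $\mathbb{M}\models\phi\vdash\psi$ iff $[\![\phi]\!]\subseteq[\![\psi]\!]$. -}

module Defs where

open import Data.Product using (_×_; _,_; proj₁; proj₂)
open import Data.Unit using (⊤)
open import Data.List using (List; []; _∷_)
open import Data.List.NonEmpty using (List⁺; _∷_)
open import Relation.Binary.PropositionalEquality using (_≡_)

Pred : Set → Set₁
Pred A = A → Set

_⊆_ : {A : Set} → Pred A → Pred A → Set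
B ⊆ C = ∀ a → B a → C a

_≐_ : {A : Set} → Pred A → Pred A → Set
B ≐ C = (B ⊆ C) × (C ⊆ B)

_∩_ : {A : Set} → Pred A → Pred A → Pred A
(B ∩ C) a = B a × C a

Full : (A : Set) → Pred A
Full A _ = ⊤

singleton : {A : Set} → A → Pred A
singleton x y = y ≡ x

up : {A X : Set} → (A → X → Set) → Pred A → Pred X
up {A} S B x = ∀ (a : A) → B a → S a x

down : {A X : Set} → (A → X → Set) → Pred X → Pred A
down {A} {X} S Y a = ∀ (x : X) → Y x → S a x

record Polarity : Set₁ where
  field
    A : Set
    X : Set
    I : A → X → Set

module _ (P : Polarity) where
  open Polarity P

  StableA : Pred A → Set
  StableA B = B ≐ down I (up I B)

  StableX : Pred X → Set
  StableX Y = Y ≐ up I (down I Y)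

  ICompatible : (A → X → Set) → Set
  ICompatible R =
    (∀ x → StableA (down R (singleton x))) × (∀ a → StableX (up R (singleton a)))

  IsConcept : Pred A → Pred X → Set
  IsConcept B Y = (B ≐ down I Y) × (Y ≐ up I B)

  cl : X → Pred X
  cl x = up I (down I (singleton x))

data Fm (Atom Ag : Set) : Set where
  atom : Atom → Fm Atom Ag
  ⊤f ⊥f : Fm Atom Ag
  _∧f_ _∨f_ : Fm Atom Ag → Fm Atom Ag → Fm Atom Ag
  □ : Ag → Fm Atom Ag → Fm Atom Ag
  C : Fm Atom Ag → Fm Atom Ag

record Model (Atom Ag : Set) : Set₁ where
  field
    pol : Polarity
  open Polarity pol public
  field
    R : Ag → A → X → Set
    Vext : Atom → Pred A
    Vdesc : Atom → Pred X
    Vconcept : ∀ p → IsConcept pol (Vext p) (Vdesc p)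

module Sem {Atom Ag : Set} (M : Model Atom Ag) where
  open Model M

  Rseq' : Ag → List Ag → A → X → Set
  Rseq' i [] = R i
  Rseq' i (j ∷ t) a x = down (R i) (up I (down (Rseq' j t) (cl pol x))) a

  Rseq : List⁺ Ag → A → X → Set
  Rseq (i ∷ t) = Rseq' i t

  RC : A → X → Set
  RC a x = ∀ (s : List⁺ Ag) → Rseq s a x

  mutual
    ext : Fm Atom Ag → Pred A
    ext (atom p) = Vext p
    ext ⊤f = Full A
    ext ⊥f = down I (Full X)
    ext (φ ∧f ψ) = ext φ ∩ ext ψ
    ext (φ ∨f ψ) = down I (desc φ ∩ desc ψ)
    ext (□ i φ) = down (R i) (desc φ)
    ext (C φ) = down RC (desc φ)

    desc : Fm Atom Ag → Pred X
    desc (atom p) = Vdesc p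
    desc ⊥f = Full X
    desc (φ ∨f ψ) = desc φ ∩ desc ψ
    desc ⊤f = up I (Full A)
    desc (φ ∧f ψ) = up I (ext φ ∩ ext ψ)
    desc (□ i φ) = up I (down (R i) (desc φ))
    desc (C φ) = up I (down RC (desc φ))

  Entails : Fm Atom Ag → Fm Atom Ag → Set
  Entails φ ψ = ext φ ⊆ ext ψ

Compositional : {Atom Ag : Set} → Model Atom Ag → Set
Compositional M = ∀ i → ICompatible (Model.pol M) (Model.R M i)

-- extension of the (possibly infinitary) conjunction ⋀_{i ∈ Ag} φ_i : intersection of extensions
BigAnd : {Atom Ag : Set} → (M : Model Atom Ag) → (Ag → Fm Atom Ag) → Pred (Polarity.A (Model.pol M))
BigAnd M f a = ∀ i → Sem.ext M (f i) a

module Submission where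

-- The proof works at the level of relations S ⊆ A × X and two properties:
--   * S is down-stable   : every S^↓[W] is Galois-stable;
--   * S is right-closed  : a S y and x ∈ y^{↓↑} imply a S x.
-- An I-compatible relation has both properties.  The composite
-- (R ; S) a x = R^↓[I^↑[S^↓[x^{↓↑}]]] a, which is how R_{it} is built from R_i
-- and R_t, inherits down-stability from R and is always right-closed, so by
-- induction every R_s has both properties.  Finally every description is
-- determined by its extension: I^↑[⟦φ⟧] ⊆ ⦅φ⦆.
--
-- (1) unfolds ⟦C φ⟧ along R_{is}, collects the witnesses into one set Z with
--     Z^↓ ⊆ ⟦C φ⟧ (down-stability), and closes with I-compatibility of R_i.
-- (2) shows χ ⊆ R_s^↓[⦅φ⦆] by induction on s, using right-closedness to
--     move from the point y to its closure y^{↓↑}.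

open import Defs
open import Data.Product using (Σ; _×_; _,_; proj₁; proj₂)
open import Data.List using ([]; _∷_)
open import Data.List.NonEmpty using (List⁺; _∷_)
open import Data.Unit using (tt)
open import Relation.Binary.PropositionalEquality using (refl)

module Galois (P : Polarity) where
  open Polarity P

  up-anti : ∀ (S : A → X → Set) {B B' : Pred A} → B ⊆ B' → up S B' ⊆ up S B
  up-anti S B⊆B' x hx a ha = hx a (B⊆B' a ha)

  down-anti : ∀ (S : A → X → Set) {Y Y' : Pred X} → Y ⊆ Y' → down S Y' ⊆ down S Y
  down-anti S Y⊆Y' a ha x hx = ha x (Y⊆Y' x hx)

  clos : Pred A → Pred A
  clos B = down I (up I B)

  clos-mono : ∀ {B B' : Pred A} → B ⊆ B' → clos B ⊆ clos B'
  clos-mono B⊆B' = down-anti I (up-anti I B⊆B')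

  cl-refl : ∀ y → cl P y y
  cl-refl y a ha = ha y refl

  cl-trans : ∀ {y x} → cl P y x → cl P x ⊆ cl P y
  cl-trans y≤x = up-anti I λ a ha → λ { _ refl → y≤x a ha }

  DownStable : (A → X → Set) → Set₁
  DownStable S = ∀ (W : Pred X) → clos (down S W) ⊆ down S W

  RightClosed : (A → X → Set) → Set
  RightClosed S = ∀ {a y x} → cl P y x → S a y → S a x

  compose : (A → X → Set) → (A → X → Set) → A → X → Set
  compose R S a x = down R (up I (down S (cl P x))) a

  -- (R ; S)^↓[W] = R^↓[⋃_{x ∈ W} I^↑[S^↓[x^{↓↑}]]], hence stable when R is.
  compose-downStable : ∀ {R} S → DownStable R → DownStable (compose R S)
  compose-downStable {R} S stableR W b hb x hx z hz =
    stableR witnesses b (clos-witnesses b hb) z (x , hx , hz)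
    where
      witnesses : Pred X
      witnesses z = Σ X λ x → W x × up I (down S (cl P x)) z

      clos-witnesses : clos (down (compose R S) W) ⊆ clos (down R witnesses)
      clos-witnesses = clos-mono λ a ha → λ { z (x , hx , hz) → ha x hx z hz }

  -- Every composite is right-closed: x^{↓↑} ⊆ y^{↓↑} propagates through three polar maps.
  compose-rightClosed : ∀ R S → RightClosed (compose R S)
  compose-rightClosed R S {a} y≤x = down-anti R (up-anti I (down-anti S (cl-trans y≤x))) a

module Compatible (P : Polarity) (R : Polarity.A P → Polarity.X P → Set)
                  (compat : ICompatible P R) where
  open Polarity P
  open Galois P

  -- From stability of each R^↓[{w}], since R^↓[W] ⊆ R^↓[{w}] for w ∈ W.
  downStable : DownStable R
  downStable W b hb w hw =
    proj₂ (proj₁ compat w) b (clos-mono (down-anti R λ { _ refl → hw }) b hb) w refl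

  -- From stability of each R^↑[{a}]: R^↓[Y] ⊆ R^↓[Y^{↓↑}].
  down-closure : ∀ (Y : Pred X) → down R Y ⊆ down R (up I (down I Y))
  down-closure Y a ha z hz =
    proj₂ (proj₂ compat a) z (up-anti I (down-anti I λ y hy → λ { _ refl → ha y hy }) z hz) a refl

  rightClosed : RightClosed R
  rightClosed {a} {y} y≤x Ray = down-closure (singleton y) a (λ { _ refl → Ray }) _ y≤x

-- Extension and description of a formula are related as in a formal concept;
-- only the inclusion I^↑[⟦φ⟧] ⊆ ⦅φ⦆ is needed, and it holds in every model.
module Concepts {Atom Ag : Set} (M : Model Atom Ag) where
  open Model M
  open Sem M

  ext⊆down-desc : ∀ φ → ext φ ⊆ down I (desc φ)
  ext⊆down-desc (atom p) = proj₁ (proj₁ (Vconcept p))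
  ext⊆down-desc ⊤f a _ x hx = hx a tt
  ext⊆down-desc ⊥f a ha = ha
  ext⊆down-desc (φ ∧f ψ) a ha x hx = hx a ha
  ext⊆down-desc (φ ∨f ψ) a ha = ha
  ext⊆down-desc (□ i φ) a ha x hx = hx a ha
  ext⊆down-desc (C φ) a ha x hx = hx a ha

  up-ext⊆desc : ∀ φ → up I (ext φ) ⊆ desc φ
  up-ext⊆desc (atom p) = proj₂ (proj₂ (Vconcept p))
  up-ext⊆desc ⊤f x hx = hx
  up-ext⊆desc ⊥f x _ = tt
  up-ext⊆desc (φ ∧f ψ) x hx = hx
  up-ext⊆desc (φ ∨f ψ) x hx =
    up-ext⊆desc φ x (λ a ha → hx a λ y (dφ , _) → ext⊆down-desc φ a ha y dφ) ,
    up-ext⊆desc ψ x (λ a ha → hx a λ y (_ , dψ) → ext⊆down-desc ψ a ha y dψ)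
  up-ext⊆desc (□ i φ) x hx = hx
  up-ext⊆desc (C φ) x hx = hx

module CommonKnowledge {Atom Ag : Set} (M : Model Atom Ag) (comp : Compositional M) where
  open Model M
  open Sem M
  open Galois pol
  open Concepts M
  module Agent (i : Ag) = Compatible pol (R i) (comp i)

  seq-downStable : ∀ j t → DownStable (Rseq' j t)
  seq-downStable j [] = Agent.downStable j
  seq-downStable j (k ∷ t) = compose-downStable (Rseq' k t) (Agent.downStable j)

  seq-rightClosed : ∀ j t → RightClosed (Rseq' j t)
  seq-rightClosed j [] = Agent.rightClosed j
  seq-rightClosed j (k ∷ t) = compose-rightClosed (R j) (Rseq' k t)

  C-unfold : ∀ φ → ext (C φ) ⊆ BigAnd M (λ i → □ i φ ∧f □ i (C φ))
  C-unfold φ a ha i = (λ x dx → ha x dx (i ∷ [])) , □C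
    where
      Z : Pred X
      Z z = Σ (List⁺ Ag) λ s → Σ X λ y → desc φ y × up I (down (Rseq s) (cl pol y)) z

      a∈RᵢZ : down (R i) Z a
      a∈RᵢZ z ((j ∷ t) , y , dy , hz) = ha y dy (i ∷ j ∷ t) z hz

      -- Each R_s^↓[y^{↓↑}] is stable, so Z^↓ lands in every R_s^↓[⦅φ⦆].
      Z↓⊆Cφ : down I Z ⊆ ext (C φ)
      Z↓⊆Cφ b hb y dy (j ∷ t) =
        seq-downStable j t (cl pol y) b (λ z hz → hb z ((j ∷ t) , y , dy , hz)) y (cl-refl y)

      □C : down (R i) (desc (C φ)) a
      □C = down-anti (R i) (up-anti I Z↓⊆Cφ) a (Agent.down-closure i Z a a∈RᵢZ)

  C-induction : ∀ φ χ → ext χ ⊆ BigAnd M (λ i → □ i φ) → ext χ ⊆ BigAnd M (λ i → □ i χ) →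
                ext χ ⊆ ext (C φ)
  C-induction φ χ χ⊢□φ χ⊢□χ b hb y dy (j ∷ t) = along j t b hb y dy
    where
      along : ∀ j t → ∀ b → ext χ b → ∀ y → desc φ y → Rseq' j t b y
      along j [] b hb y dy = χ⊢□φ b hb j y dy
      along j (k ∷ t) b hb y dy = down-anti (R j) reach⊆χ b (χ⊢□χ b hb j)
        where
          -- ⟦χ⟧ ⊆ R_{kt}^↓[y^{↓↑}], hence I^↑[R_{kt}^↓[y^{↓↑}]] ⊆ I^↑[⟦χ⟧] ⊆ ⦅χ⦆.
          reach⊆χ : up I (down (Rseq' k t) (cl pol y)) ⊆ desc χ
          reach⊆χ z hz = up-ext⊆desc χ z λ b' hb' →
            hz b' λ x y≤x → seq-rightClosed k t y≤x (along k t b' hb' y dy)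

propositionA14 : {Atom Ag : Set} (M : Model Atom Ag) → Compositional M →
    (∀ (φ : Fm Atom Ag) →
    Sem.ext M (C φ) ⊆ BigAnd M (λ i → □ i φ ∧f □ i (C φ)))
    × (∀ (φ χ : Fm Atom Ag) →
    Sem.ext M χ ⊆ BigAnd M (λ i → □ i φ) →
    Sem.ext M χ ⊆ BigAnd M (λ i → □ i χ) →
    Sem.ext M χ ⊆ Sem.ext M (C φ))
propositionA14 M comp = C-unfold , C-induction
  where open CommonKnowledge M comp
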